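{- Let $p$ be a prime and let $C,E,F$ be integers with $C>0$, $E>0$, $E$ and $F$ not both divisible by $p$, and $En+F\ne0$ for all integers $n\ge0$. Regard $s_p(Cn)$ and $v_p(En+F)$ as random variables for $n$ chosen uniformly from $\{0,1,\ldots,N-1\}$. Then, as $N\to\infty$, \[ \operatorname{Cov}_N\big(s_p(Cn),v_p(En+F)\big)=O\big((\log_p N)^{1/2}\big). \]
   Context: $s_p(m)$ denotes the sum of the digits of the base-$p$ expansion of the non-negative integer $m$. For a nonzero integer $M$, $v_p(M)$ is the largest $\beta\ge0$ with $p^\beta\mid M$. For functions $X,Y$ on the non-negative integers, $\operatorname{Cov}_N(X,Y)=\frac1N\sum_{n<N}X(n)Y(n)-\Big(\frac1N\sum_{n<N}X(n)\Big)\Big(\frac1N\sum_{n<N}Y(n)\Big)$. -}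

module Defs where

open import Data.Nat using (ℕ; zero; suc; _+_; _*_; _/_; _%_; _≟_)
open import Data.Integer using (ℤ; +_)
open import Data.Rational using (ℚ; 0ℚ; _-_) renaming (_*_ to _*ℚ_; _/_ to _/ℚ_)
open import Relation.Nullary using (yes; no)

sumBelow : ℕ → (ℕ → ℕ) → ℕ
sumBelow zero    f = 0
sumBelow (suc N) f = sumBelow N f + f N

-- s_p(m): sum of base-p digits of m (meaningful for p ≥ 2; fuel m suffices)
digitSum : (p : ℕ) → ℕ → ℕ
digitSum zero    m = 0
digitSum (suc q) m = go m m
  where
  go : ℕ → ℕ → ℕ
  go zero    k = 0
  go (suc f) k = k % suc q + go f (k / suc q)

-- v_p(M) for a natural number M ≠ 0 (applied to |M| for integers):
-- the largest β with p^β ∣ M (computed by repeated division; fuel M suffices)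
valuation : (p : ℕ) → ℕ → ℕ
valuation zero    m = 0
valuation (suc q) m = go m m
  where
  go : ℕ → ℕ → ℕ
  go zero    k = 0
  go (suc f) zero = 0
  go (suc f) (suc k) with (suc k) % suc q ≟ 0
  ... | yes _ = suc (go f (suc k / suc q))
  ... | no  _ = 0

-- number of base-p digits of N; equals ⌊log_p N⌋ + 1 for N ≥ 1
numDigits : (p : ℕ) → ℕ → ℕ
numDigits zero    m = 0
numDigits (suc q) m = go m m
  where
  go : ℕ → ℕ → ℕ
  go zero    k = 0
  go (suc f) zero = 0
  go (suc f) (suc k) = suc (go f (suc k / suc q))

Cov : ℕ → (ℕ → ℕ) → (ℕ → ℕ) → ℚ
Cov zero    X Y = 0ℚ
Cov (suc m) X Y =
  ((+ sumBelow (suc m) (λ n → X n * Y n)) /ℚ suc m)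
  - (((+ sumBelow (suc m) X) /ℚ suc m) *ℚ ((+ sumBelow (suc m) Y) /ℚ suc m))

module Submission where

-- Cov_N = S / N² with S = N Σ XY − Σ X Σ Y.  Shifting X by k(p−1)/2, where k is the number of
-- base-p digits of N, and applying Cauchy–Schwarz gives (2S)² ≤ N² · Σ (2X − k(p−1))² · Σ Y².
-- The first sum is O(N k): the n < p^k give distinct multiples Cn < C p^k, s_p(j + p^k i) = s_p(j) + s_p(i)
-- for j < p^k, and over m < p^k the digit sum is a sum of k independent uniform digits.
-- The second sum is O(N): Y(n)² = Σ_{j<Y(n)} (2j+1); when p ∤ E the n < N with p^(j+1) | En+F lie
-- in one residue class mod p^(j+1), so there are at most (N + EN + |F|)/p^(j+1) of them, and
-- Σ_j (2j+1)/2^(j+1) = 3.  When p | E, p ∤ F and Y vanishes.  Hence Cov_N² ≤ K k.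

open import Data.Nat.Base using (ℕ; suc; NonZero)
open import Data.Integer.Base using (ℤ)
open import Data.Nat.Primality using (Prime; prime⇒nonTrivial)

module IntegerSums where
  open import Defs using (sumBelow)
  open import Data.Nat as ℕ using (zero; suc; z≤n; s≤s)
  import Data.Nat.Properties as ℕₚ
  open import Data.Integer using (+_; -[1+_]; 0ℤ; 1ℤ; _+_; _*_; -_; _-_; _≤_; +≤+; nonNegative)
  open import Data.Integer.Properties
  open import Data.Integer.Tactic.RingSolver using (solve-∀)
  open import Data.Product using (_,_)
  open import Relation.Binary.PropositionalEquality

  square-nonNeg : ∀ i → 0ℤ ≤ i * i
  square-nonNeg (+ zero)    = +≤+ z≤n
  square-nonNeg (+ suc n)   = +≤+ z≤n
  square-nonNeg -[1+ n ]    = +≤+ z≤n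

  *-nonNeg : ∀ {i j} → 0ℤ ≤ i → 0ℤ ≤ j → 0ℤ ≤ i * j
  *-nonNeg {i} {j} 0≤i 0≤j = subst (_≤ i * j) (*-zeroʳ i) (*-monoˡ-≤-nonNeg i ⦃ nonNegative 0≤i ⦄ 0≤j)

  square-mono : ∀ {m n} → m ℕ.≤ n → + m * + m ≤ + n * + n
  square-mono {m} {n} m≤n = subst₂ _≤_ (pos-* m m) (pos-* n n) (+≤+ (ℕₚ.*-mono-≤ m≤n m≤n))

  square-+-≤ : ∀ a b → (a + b) * (a + b) ≤ + 2 * (a * a) + + 2 * (b * b)
  square-+-≤ a b = 0≤i-j⇒j≤i (subst (0ℤ ≤_) (sym (gap a b)) (square-nonNeg (a - b)))
    where
    gap : ∀ a b → + 2 * (a * a) + + 2 * (b * b) - (a + b) * (a + b) ≡ (a - b) * (a - b)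
    gap = solve-∀

  sumℤ : ℕ → (ℕ → ℤ) → ℤ
  sumℤ zero    f = 0ℤ
  sumℤ (suc N) f = sumℤ N f + f N

  infix 5 sumℤ
  syntax sumℤ N (λ n → e) = ∑[ n < N ] e

  sumBelow≡sumℤ : ∀ N f → + sumBelow N f ≡ ∑[ n < N ] + f n
  sumBelow≡sumℤ zero    f = refl
  sumBelow≡sumℤ (suc N) f = trans (pos-+ (sumBelow N f) (f N)) (cong (_+ + f N) (sumBelow≡sumℤ N f))

  sumℤ-cong : ∀ N {f g : ℕ → ℤ} → (∀ {n} → n ℕ.< N → f n ≡ g n) → sumℤ N f ≡ sumℤ N g
  sumℤ-cong zero    f≡g = refl
  sumℤ-cong (suc N) f≡g = cong₂ _+_ (sumℤ-cong N (λ n<N → f≡g (ℕₚ.m<n⇒m<1+n n<N))) (f≡g ℕₚ.≤-refl)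

  sumℤ-+ : ∀ N (f g : ℕ → ℤ) → ∑[ n < N ] (f n + g n) ≡ sumℤ N f + sumℤ N g
  sumℤ-+ zero    f g = refl
  sumℤ-+ (suc N) f g = trans (cong (_+ (f N + g N)) (sumℤ-+ N f g)) (interchange (sumℤ N f) (sumℤ N g) (f N) (g N))
    where
    interchange : ∀ a b c d → (a + b) + (c + d) ≡ (a + c) + (b + d)
    interchange = solve-∀

  sumℤ-*ˡ : ∀ N c (f : ℕ → ℤ) → ∑[ n < N ] (c * f n) ≡ c * sumℤ N f
  sumℤ-*ˡ zero    c f = sym (*-zeroʳ c)
  sumℤ-*ˡ (suc N) c f = trans (cong (_+ c * f N) (sumℤ-*ˡ N c f)) (sym (*-distribˡ-+ c (sumℤ N f) (f N)))

  sumℤ-const : ∀ N c → ∑[ n < N ] c ≡ + N * c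
  sumℤ-const zero    c = sym (*-zeroˡ c)
  sumℤ-const (suc N) c = trans (cong (_+ c) (sumℤ-const N c)) (step (+ N) c)
    where
    step : ∀ n c → n * c + c ≡ (1ℤ + n) * c
    step = solve-∀

  sumℤ-linear : ∀ N α β (f g : ℕ → ℤ) → ∑[ n < N ] (α * f n + β * g n) ≡ α * sumℤ N f + β * sumℤ N g
  sumℤ-linear N α β f g = trans (sumℤ-+ N _ _) (cong₂ _+_ (sumℤ-*ˡ N α f) (sumℤ-*ˡ N β g))

  sumℤ-affine² : ∀ N α β (u : ℕ → ℤ) →
    ∑[ n < N ] (α * u n + β) * (α * u n + β) ≡ α * α * (∑[ n < N ] u n * u n) + + 2 * α * β * sumℤ N u + + N * (β * β)
  sumℤ-affine² N α β u = begin
    ∑[ n < N ] (α * u n + β) * (α * u n + β)                        ≡⟨ sumℤ-cong N (λ {n} _ → expand α β (u n)) ⟩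
    ∑[ n < N ] (α * α * (u n * u n) + + 2 * α * β * u n + β * β)     ≡⟨ sumℤ-+ N _ (λ _ → β * β) ⟩
    (∑[ n < N ] (α * α * (u n * u n) + + 2 * α * β * u n)) + (∑[ n < N ] β * β)
      ≡⟨ cong₂ _+_ (sumℤ-linear N (α * α) (+ 2 * α * β) _ u) (sumℤ-const N (β * β)) ⟩
    α * α * (∑[ n < N ] u n * u n) + + 2 * α * β * sumℤ N u + + N * (β * β) ∎
    where
    open ≡-Reasoning
    expand : ∀ α β u → (α * u + β) * (α * u + β) ≡ α * α * (u * u) + + 2 * α * β * u + β * β
    expand = solve-∀

  ∑-odd : ∀ n → ∑[ i < n ] (+ 2 * + i + 1ℤ) ≡ + n * + n
  ∑-odd zero    = refl
  ∑-odd (suc n) = trans (cong (_+ (+ 2 * + n + 1ℤ)) (∑-odd n)) (step (+ n))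
    where
    step : ∀ n → n * n + (+ 2 * n + 1ℤ) ≡ (1ℤ + n) * (1ℤ + n)
    step = solve-∀

  sumℤ-mono-≤ : ∀ N {f g : ℕ → ℤ} → (∀ {n} → n ℕ.< N → f n ≤ g n) → sumℤ N f ≤ sumℤ N g
  sumℤ-mono-≤ zero    f≤g = ≤-refl
  sumℤ-mono-≤ (suc N) f≤g = +-mono-≤ (sumℤ-mono-≤ N (λ n<N → f≤g (ℕₚ.m<n⇒m<1+n n<N))) (f≤g ℕₚ.≤-refl)

  sumℤ-nonNeg : ∀ N {f : ℕ → ℤ} → (∀ {n} → n ℕ.< N → 0ℤ ≤ f n) → 0ℤ ≤ sumℤ N f
  sumℤ-nonNeg N {f} 0≤f = subst (_≤ sumℤ N f) (trans (sumℤ-const N 0ℤ) (*-zeroʳ (+ N))) (sumℤ-mono-≤ N 0≤f)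

  sumℤ-+-range : ∀ a b (f : ℕ → ℤ) → sumℤ (a ℕ.+ b) f ≡ sumℤ a f + (∑[ i < b ] f (a ℕ.+ i))
  sumℤ-+-range a zero    f = trans (cong (λ N → sumℤ N f) (ℕₚ.+-identityʳ a)) (sym (+-identityʳ (sumℤ a f)))
  sumℤ-+-range a (suc b) f = begin
    sumℤ (a ℕ.+ suc b) f                                ≡⟨ cong (λ N → sumℤ N f) (ℕₚ.+-suc a b) ⟩
    sumℤ (a ℕ.+ b) f + f (a ℕ.+ b)                      ≡⟨ cong (_+ f (a ℕ.+ b)) (sumℤ-+-range a b f) ⟩
    sumℤ a f + (∑[ i < b ] f (a ℕ.+ i)) + f (a ℕ.+ b)   ≡⟨ +-assoc (sumℤ a f) _ _ ⟩
    sumℤ a f + (∑[ i < suc b ] f (a ℕ.+ i))             ∎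
    where open ≡-Reasoning

  sumℤ-monoˡ-≤ : ∀ {N M} (f : ℕ → ℤ) → (∀ n → 0ℤ ≤ f n) → N ℕ.≤ M → sumℤ N f ≤ sumℤ M f
  sumℤ-monoˡ-≤ {N} f 0≤f N≤M with ℕₚ.m≤n⇒∃[o]m+o≡n N≤M
  ... | d , refl = begin
    sumℤ N f                            ≡⟨ +-identityʳ (sumℤ N f) ⟨
    sumℤ N f + 0ℤ                       ≤⟨ +-monoʳ-≤ (sumℤ N f) (sumℤ-nonNeg d (λ _ → 0≤f _)) ⟩
    sumℤ N f + (∑[ i < d ] f (N ℕ.+ i)) ≡⟨ sumℤ-+-range N d f ⟨
    sumℤ (N ℕ.+ d) f                    ∎
    where open ≤-Reasoning

  sumℤ-blocks : ∀ R P (f : ℕ → ℤ) → sumℤ (R ℕ.* P) f ≡ ∑[ r < R ] ∑[ i < P ] f (r ℕ.* P ℕ.+ i)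
  sumℤ-blocks zero    P f = refl
  sumℤ-blocks (suc R) P f = begin
    sumℤ (P ℕ.+ R ℕ.* P) f                                 ≡⟨ cong (λ N → sumℤ N f) (ℕₚ.+-comm P (R ℕ.* P)) ⟩
    sumℤ (R ℕ.* P ℕ.+ P) f                                 ≡⟨ sumℤ-+-range (R ℕ.* P) P f ⟩
    sumℤ (R ℕ.* P) f + (∑[ i < P ] f (R ℕ.* P ℕ.+ i))       ≡⟨ cong₂ _+_ (sumℤ-blocks R P f) refl ⟩
    (∑[ r < R ] ∑[ i < P ] f (r ℕ.* P ℕ.+ i)) + (∑[ i < P ] f (R ℕ.* P ℕ.+ i)) ∎
    where open ≡-Reasoning

  sumℤ-multiples-≤ : ∀ M c (f : ℕ → ℤ) → (∀ m → 0ℤ ≤ f m) → ∑[ n < M ] f (n ℕ.* suc c) ≤ sumℤ (M ℕ.* suc c) f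
  sumℤ-multiples-≤ M c f 0≤f = begin
    ∑[ n < M ] f (n ℕ.* suc c)                         ≤⟨ sumℤ-mono-≤ M (λ {n} _ → first-term n) ⟩
    ∑[ n < M ] ∑[ i < suc c ] f (n ℕ.* suc c ℕ.+ i)     ≡⟨ sumℤ-blocks M (suc c) f ⟨
    sumℤ (M ℕ.* suc c) f                               ∎
    where
    open ≤-Reasoning
    first-term : ∀ n → f (n ℕ.* suc c) ≤ ∑[ i < suc c ] f (n ℕ.* suc c ℕ.+ i)
    first-term n = subst (_≤ ∑[ i < suc c ] f (n ℕ.* suc c ℕ.+ i))
      (trans (+-identityˡ _) (cong f (ℕₚ.+-identityʳ (n ℕ.* suc c))))
      (sumℤ-monoˡ-≤ (λ i → f (n ℕ.* suc c ℕ.+ i)) (λ i → 0≤f _) (s≤s (z≤n {c})))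

  sumℤ-comm : ∀ N M (g : ℕ → ℕ → ℤ) → ∑[ n < N ] ∑[ m < M ] g n m ≡ ∑[ m < M ] ∑[ n < N ] g n m
  sumℤ-comm zero    M g = sym (trans (sumℤ-const M 0ℤ) (*-zeroʳ (+ M)))
  sumℤ-comm (suc N) M g = trans (cong₂ _+_ (sumℤ-comm N M g) refl) (sym (sumℤ-+ M (λ m → ∑[ n < N ] g n m) (g N)))

  lagrange-identity : ∀ N (a b : ℕ → ℤ) →
    (∑[ n < N ] a n * a n) * (∑[ n < N ] b n * b n) - (∑[ n < N ] a n * b n) * (∑[ n < N ] a n * b n)
      ≡ ∑[ n < N ] ∑[ i < n ] (a n * b i - b n * a i) * (a n * b i - b n * a i)
  lagrange-identity zero    a b = refl
  lagrange-identity (suc N) a b = begin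
    (A + x * x) * (B + y * y) - (s + x * y) * (s + x * y)   ≡⟨ step A B s x y ⟩
    (A * B - s * s) + (x * x * B + (- (+ 2 * x * y)) * s + y * y * A)
      ≡⟨ cong₂ _+_ (lagrange-identity N a b) (sym new-terms) ⟩
    (∑[ n < N ] ∑[ i < n ] (a n * b i - b n * a i) * (a n * b i - b n * a i))
      + (∑[ i < N ] (x * b i - y * a i) * (x * b i - y * a i)) ∎
    where
    open ≡-Reasoning
    A = ∑[ n < N ] a n * a n
    B = ∑[ n < N ] b n * b n
    s = ∑[ n < N ] a n * b n
    x = a N
    y = b N
    step : ∀ A B s x y → (A + x * x) * (B + y * y) - (s + x * y) * (s + x * y)
      ≡ (A * B - s * s) + (x * x * B + (- (+ 2 * x * y)) * s + y * y * A)
    step = solve-∀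
    expand : ∀ x y a b → (x * b - y * a) * (x * b - y * a) ≡ x * x * (b * b) + (- (+ 2 * x * y)) * (a * b) + y * y * (a * a)
    expand = solve-∀
    new-terms : ∑[ i < N ] (x * b i - y * a i) * (x * b i - y * a i) ≡ x * x * B + (- (+ 2 * x * y)) * s + y * y * A
    new-terms = begin
      ∑[ i < N ] (x * b i - y * a i) * (x * b i - y * a i)
        ≡⟨ sumℤ-cong N (λ {i} _ → expand x y (a i) (b i)) ⟩
      ∑[ i < N ] (x * x * (b i * b i) + (- (+ 2 * x * y)) * (a i * b i) + y * y * (a i * a i))
        ≡⟨ sumℤ-+ N _ _ ⟩
      (∑[ i < N ] (x * x * (b i * b i) + (- (+ 2 * x * y)) * (a i * b i))) + (∑[ i < N ] y * y * (a i * a i))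
        ≡⟨ cong₂ _+_ (sumℤ-linear N (x * x) (- (+ 2 * x * y)) _ _) (sumℤ-*ˡ N (y * y) _) ⟩
      x * x * B + (- (+ 2 * x * y)) * s + y * y * A ∎

  cauchy-schwarz : ∀ N (a b : ℕ → ℤ) →
    (∑[ n < N ] a n * b n) * (∑[ n < N ] a n * b n) ≤ (∑[ n < N ] a n * a n) * (∑[ n < N ] b n * b n)
  cauchy-schwarz N a b = 0≤i-j⇒j≤i (subst (0ℤ ≤_) (sym (lagrange-identity N a b))
    (sumℤ-nonNeg N (λ {n} _ → sumℤ-nonNeg n (λ {i} _ → square-nonNeg (a n * b i - b n * a i)))))

  covSum : ℕ → (ℕ → ℤ) → (ℕ → ℤ) → ℤ
  covSum N x y = + N * (∑[ n < N ] x n * y n) - sumℤ N x * sumℤ N y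

  covSum-affine : ∀ N α β (x y : ℕ → ℤ) → covSum N (λ n → α * x n + β) y ≡ α * covSum N x y
  covSum-affine N α β x y = begin
    + N * (∑[ n < N ] (α * x n + β) * y n) - (∑[ n < N ] (α * x n + β)) * sumℤ N y
      ≡⟨ cong₂ (λ s t → + N * s - t * sumℤ N y) products sums ⟩
    + N * (α * Sxy + β * Sy) - (α * Sx + + N * β) * Sy ≡⟨ rearrange (+ N) α β Sxy Sx Sy ⟩
    α * (+ N * Sxy - Sx * Sy) ∎
    where
    open ≡-Reasoning
    Sxy = ∑[ n < N ] x n * y n
    Sx = sumℤ N x
    Sy = sumℤ N y
    distrib : ∀ α β x y → (α * x + β) * y ≡ α * (x * y) + β * y
    distrib = solve-∀
    rearrange : ∀ n α β sxy sx sy → n * (α * sxy + β * sy) - (α * sx + n * β) * sy ≡ α * (n * sxy - sx * sy)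
    rearrange = solve-∀
    products : ∑[ n < N ] (α * x n + β) * y n ≡ α * Sxy + β * Sy
    products = trans (sumℤ-cong N (λ {n} _ → distrib α β (x n) (y n))) (sumℤ-linear N α β _ y)
    sums : ∑[ n < N ] (α * x n + β) ≡ α * Sx + + N * β
    sums = trans (sumℤ-+ N _ (λ _ → β)) (cong₂ _+_ (sumℤ-*ˡ N α x) (sumℤ-const N β))

  covSum-bound : ∀ N (u y : ℕ → ℤ) →
    covSum N u y * covSum N u y ≤ + N * + N * (∑[ n < N ] u n * u n) * (∑[ n < N ] y n * y n)
  covSum-bound N u y = begin
    covSum N u y * covSum N u y                ≡⟨ cong (λ s → s * s) centred ⟩
    (∑[ n < N ] d n * y n) * (∑[ n < N ] d n * y n) ≤⟨ cauchy-schwarz N d y ⟩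
    (∑[ n < N ] d n * d n) * Syy              ≡⟨ cong (_* Syy) centred-squares ⟩
    (n² * Suu - + N * (U * U)) * Syy         ≤⟨ *-monoʳ-≤-nonNeg Syy ⦃ nonNegative 0≤Syy ⦄ drop-NUU ⟩
    n² * Suu * Syy                           ∎
    where
    open ≤-Reasoning
    U = sumℤ N u
    n² = + N * + N
    Suu = ∑[ n < N ] u n * u n
    Syy = ∑[ n < N ] y n * y n
    d : ℕ → ℤ
    d n = + N * u n - U
    0≤Syy : 0ℤ ≤ Syy
    0≤Syy = sumℤ-nonNeg N (λ {n} _ → square-nonNeg (y n))
    drop-NUU : n² * Suu - + N * (U * U) ≤ n² * Suu
    drop-NUU = i-j≤i (n² * Suu) (+ N * (U * U)) ⦃ nonNegative (*-nonNeg {+ N} (+≤+ z≤n) (square-nonNeg U)) ⦄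
    distrib : ∀ n u U y → (n * u - U) * y ≡ n * (u * y) + (- U) * y
    distrib = solve-∀
    negate : ∀ n s U t → n * s + (- U) * t ≡ n * s - U * t
    negate = solve-∀
    centred : covSum N u y ≡ ∑[ n < N ] d n * y n
    centred = sym (trans (sumℤ-cong N (λ {i} _ → distrib (+ N) (u i) U (y i)))
      (trans (sumℤ-linear N (+ N) (- U) _ y) (negate (+ N) (∑[ n < N ] u n * y n) U (sumℤ N y))))
    collect : ∀ n s U → n * n * s + + 2 * n * (- U) * U + n * (- U * - U) ≡ n * n * s - n * (U * U)
    collect = solve-∀
    centred-squares : ∑[ n < N ] d n * d n ≡ n² * Suu - + N * (U * U)
    centred-squares = trans (sumℤ-affine² N (+ N) (- U) u) (collect (+ N) Suu U)

module Counting where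
  open IntegerSums
  open import Data.Nat as ℕ using (zero; suc; z≤n; _^_)
  import Data.Nat.Properties as ℕₚ
  open import Data.Integer using (+_; 0ℤ; 1ℤ; _+_; _*_; -_; _-_; _≤_; +≤+; +<+; positive; nonNegative)
  open import Data.Integer.Properties
  open import Data.Integer.Tactic.RingSolver using (solve-∀)
  open import Relation.Nullary using (Dec; yes; no)
  open import Relation.Unary using (Pred; Decidable)
  open import Relation.Binary.PropositionalEquality

  indicator : ∀ {a} {A : Set a} → Dec A → ℤ
  indicator (yes _) = 1ℤ
  indicator (no  _) = 0ℤ

  indicator-nonNeg : ∀ {a} {A : Set a} (A? : Dec A) → 0ℤ ≤ indicator A?
  indicator-nonNeg (yes _) = +≤+ z≤n
  indicator-nonNeg (no  _) = +≤+ z≤n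

  indicator-yes : ∀ {a} {A : Set a} (A? : Dec A) → A → indicator A? ≡ 1ℤ
  indicator-yes (yes _) _ = refl
  indicator-yes (no ¬a) a with () ← ¬a a

  count : ∀ {ℓ} {P : Pred ℕ ℓ} → Decidable P → ℕ → ℕ
  count P? zero = 0
  count P? (suc N) with P? N
  ... | yes _ = suc (count P? N)
  ... | no  _ = count P? N

  sumℤ-indicator : ∀ {ℓ} {P : Pred ℕ ℓ} (P? : Decidable P) N → ∑[ n < N ] indicator (P? n) ≡ + count P? N
  sumℤ-indicator P? zero = refl
  sumℤ-indicator P? (suc N) with P? N
  ... | yes _ = trans (cong (_+ 1ℤ) (sumℤ-indicator P? N)) (cong +_ (ℕₚ.+-comm (count P? N) 1))
  ... | no  _ = trans (+-identityʳ _) (sumℤ-indicator P? N)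

  module _ {ℓ} {P : Pred ℕ ℓ} (P? : Decidable P) (Q : ℕ) (spaced : ∀ {h n} → h ℕ.< n → P h → P n → h ℕ.+ Q ℕ.≤ n) where

    count-≤-hit : ∀ N {n} → N ℕ.≤ n → P n → Q ℕ.* count P? N ℕ.≤ n
    count-≤-hit zero    _ _ = ℕₚ.≤-trans (ℕₚ.≤-reflexive (ℕₚ.*-zeroʳ Q)) z≤n
    count-≤-hit (suc N) {n} N<n Pn with P? N
    ... | no  _  = count-≤-hit N (ℕₚ.<⇒≤ N<n) Pn
    ... | yes PN = begin
      Q ℕ.* suc (count P? N)   ≡⟨ ℕₚ.*-suc Q (count P? N) ⟩
      Q ℕ.+ Q ℕ.* count P? N   ≤⟨ ℕₚ.+-monoʳ-≤ Q (count-≤-hit N ℕₚ.≤-refl PN) ⟩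
      Q ℕ.+ N                  ≡⟨ ℕₚ.+-comm Q N ⟩
      N ℕ.+ Q                  ≤⟨ spaced N<n PN Pn ⟩
      n                        ∎
      where open ℕₚ.≤-Reasoning

    count-≤ : ∀ N L → (∀ {n} → n ℕ.< N → P n → Q ℕ.≤ L) → Q ℕ.* count P? N ℕ.≤ N ℕ.+ L
    count-≤ zero    L _     = ℕₚ.≤-trans (ℕₚ.≤-reflexive (ℕₚ.*-zeroʳ Q)) z≤n
    count-≤ (suc N) L Q≤L with P? N
    ... | no  _  = ℕₚ.m≤n⇒m≤1+n (count-≤ N L (λ n<N → Q≤L (ℕₚ.m<n⇒m<1+n n<N)))
    ... | yes PN = begin
      Q ℕ.* suc (count P? N)   ≡⟨ ℕₚ.*-suc Q (count P? N) ⟩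
      Q ℕ.+ Q ℕ.* count P? N   ≤⟨ ℕₚ.+-mono-≤ (Q≤L ℕₚ.≤-refl PN) (count-≤-hit N ℕₚ.≤-refl PN) ⟩
      L ℕ.+ N                  ≤⟨ ℕₚ.n≤1+n _ ⟩
      suc (L ℕ.+ N)            ≡⟨ cong suc (ℕₚ.+-comm L N) ⟩
      suc N ℕ.+ L              ∎
      where open ℕₚ.≤-Reasoning

  square≤∑odd : ∀ {Y J} (f : ℕ → ℤ) → Y ℕ.≤ J → (∀ {j} → j ℕ.< Y → f j ≡ 1ℤ) → (∀ j → 0ℤ ≤ f j) →
    + Y * + Y ≤ ∑[ j < J ] (+ 2 * + j + 1ℤ) * f j
  square≤∑odd {Y} {J} f Y≤J f≡1 0≤f = begin
    + Y * + Y                                ≡⟨ ∑-odd Y ⟨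
    ∑[ j < Y ] (+ 2 * + j + 1ℤ)              ≡⟨ sumℤ-cong Y weighted ⟩
    ∑[ j < Y ] (+ 2 * + j + 1ℤ) * f j        ≤⟨ sumℤ-monoˡ-≤ _ (λ j → *-nonNeg (odd-nonNeg j) (0≤f j)) Y≤J ⟩
    ∑[ j < J ] (+ 2 * + j + 1ℤ) * f j        ∎
    where
    open ≤-Reasoning
    odd-nonNeg : ∀ j → 0ℤ ≤ + 2 * + j + 1ℤ
    odd-nonNeg j = +-mono-≤ (*-nonNeg {+ 2} {+ j} (+≤+ z≤n) (+≤+ z≤n)) (+≤+ z≤n)
    weighted : ∀ {j} → j ℕ.< Y → + 2 * + j + 1ℤ ≡ (+ 2 * + j + 1ℤ) * f j
    weighted {j} j<Y = trans (sym (*-identityʳ _)) (cong ((+ 2 * + j + 1ℤ) *_) (sym (f≡1 j<Y)))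

  ∑-odd-weights-≤ : ∀ J (x : ℕ → ℤ) {A} → 0ℤ ≤ A → (∀ j → + (2 ^ suc j) * x j ≤ A) →
    ∑[ j < J ] (+ 2 * + j + 1ℤ) * x j ≤ + 3 * A
  ∑-odd-weights-≤ J x {A} 0≤A 2^j+1x≤A = *-cancelˡ-≤-pos _ (+ 3 * A) (+ 2^J) ⦃ positive (+<+ (ℕₚ.m^n>0 2 J)) ⦄ (begin
    + 2^J * S J                                ≤⟨ i≤i+j (+ 2^J * S J) _ ⦃ nonNegative (*-nonNeg (tail-nonNeg J) 0≤A) ⦄ ⟩
    + 2^J * S J + (+ 2 * + J + + 3) * A         ≤⟨ partial J ⟩
    + 3 * + 2^J * A                            ≡⟨ reorder (+ 2^J) A ⟩
    + 2^J * (+ 3 * A)                          ∎)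
    where
    open ≤-Reasoning
    2^J = 2 ^ J
    S : ℕ → ℤ
    S J = ∑[ j < J ] (+ 2 * + j + 1ℤ) * x j
    tail-nonNeg : ∀ J → 0ℤ ≤ + 2 * + J + + 3
    tail-nonNeg J = +-mono-≤ (*-nonNeg {+ 2} {+ J} (+≤+ z≤n) (+≤+ z≤n)) (+≤+ z≤n)
    reorder : ∀ P A → + 3 * P * A ≡ P * (+ 3 * A)
    reorder = solve-∀
    -- Σ_{j<J} (2j+1)/2^(j+1) = 3 − (2J+3)/2^J
    partial : ∀ J → + (2 ^ J) * S J + (+ 2 * + J + + 3) * A ≤ + 3 * + (2 ^ J) * A
    partial zero    = ≤-reflexive (base A)
      where
      base : ∀ A → + 1 * 0ℤ + (+ 2 * + 0 + + 3) * A ≡ + 3 * + 1 * A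
      base = solve-∀
    partial (suc J) = begin
      + (2 ℕ.* P) * (S J + w * x J) + (+ 2 * (1ℤ + + J) + + 3) * A
        ≡⟨ cong (λ T → T * (S J + w * x J) + (+ 2 * (1ℤ + + J) + + 3) * A) (pos-* 2 P) ⟩
      (+ 2 * + P) * (S J + w * x J) + (+ 2 * (1ℤ + + J) + + 3) * A
        ≡⟨ expand (+ P) (S J) (+ J) (x J) A ⟩
      + 2 * (+ P * S J + (+ 2 * + J + + 3) * A) + w * ((+ 2 * + P) * x J) - w * A
        ≤⟨ +-monoˡ-≤ (- (w * A)) (+-mono-≤ (*-monoˡ-≤-nonNeg (+ 2) (partial J))
                                           (*-monoˡ-≤-nonNeg w ⦃ nonNegative-w ⦄ 2Px≤A)) ⟩
      + 2 * (+ 3 * + P * A) + w * A - w * A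
        ≡⟨ collapse (+ P) w A ⟩
      + 3 * (+ 2 * + P) * A
        ≡⟨ cong (λ T → + 3 * T * A) (pos-* 2 P) ⟨
      + 3 * + (2 ℕ.* P) * A ∎
      where
      P = 2 ^ J
      w = + 2 * + J + 1ℤ
      nonNegative-w = nonNegative (+-mono-≤ (*-nonNeg {+ 2} {+ J} (+≤+ z≤n) (+≤+ z≤n)) (+≤+ z≤n))
      2Px≤A : (+ 2 * + P) * x J ≤ A
      2Px≤A = subst (λ T → T * x J ≤ A) (pos-* 2 P) (2^j+1x≤A J)
      expand : ∀ P S J x A → (+ 2 * P) * (S + (+ 2 * J + 1ℤ) * x) + (+ 2 * (1ℤ + J) + + 3) * A
        ≡ + 2 * (P * S + (+ 2 * J + + 3) * A) + (+ 2 * J + 1ℤ) * ((+ 2 * P) * x) - (+ 2 * J + 1ℤ) * A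
      expand = solve-∀
      collapse : ∀ P w A → + 2 * (+ 3 * P * A) + w * A - w * A ≡ + 3 * (+ 2 * P) * A
      collapse = solve-∀

module Digits (q : ℕ) .{{_ : NonZero q}} where
  open import Defs using (digitSum; numDigits; valuation)
  open import Data.Nat
  open import Data.Nat.Properties
  open import Data.Nat.DivMod
  open import Data.Nat.Divisibility using (_∣_; divides; *-monoʳ-∣; m%n≡0⇒n∣m)
  open import Relation.Nullary using (yes; no; ¬_; contradiction)
  open import Relation.Binary.PropositionalEquality

  p : ℕ
  p = suc q

  [1+k]/p≤k : ∀ k → suc k / p ≤ k
  [1+k]/p≤k k = s≤s⁻¹ (m/n<m (suc k) p (s≤s (>-nonZero⁻¹ q)))

  digitSumFuel : ℕ → ℕ → ℕ
  digitSumFuel zero    k = 0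
  digitSumFuel (suc f) k = k % p + digitSumFuel f (k / p)

  numDigitsFuel : ℕ → ℕ → ℕ
  numDigitsFuel zero    k       = 0
  numDigitsFuel (suc f) zero    = 0
  numDigitsFuel (suc f) (suc k) = suc (numDigitsFuel f (suc k / p))

  valuationFuel : ℕ → ℕ → ℕ
  valuationFuel zero    k       = 0
  valuationFuel (suc f) zero    = 0
  valuationFuel (suc f) (suc k) with suc k % p ≟ 0
  ... | yes _ = suc (valuationFuel f (suc k / p))
  ... | no  _ = 0

  -- Defs hides each recursion in a `where` block.  In each mutual block below, the `_` in the
  -- type of `go≡…` is solved, through the `with`-generalised call above it, as that hidden `go`.
  mutual
    digitSum≡digitSumFuel : ∀ m → digitSum p m ≡ digitSumFuel m m
    digitSum≡digitSumFuel zero = refl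
    digitSum≡digitSumFuel (suc m) with suc m | suc m / p
    ... | M | k = cong (M % p +_) (go≡digitSumFuel M m k)

    private
      go≡digitSumFuel : ∀ M f k → _ ≡ digitSumFuel f k
      go≡digitSumFuel M zero    k = refl
      go≡digitSumFuel M (suc f) k = cong (k % p +_) (go≡digitSumFuel M f (k / p))

  mutual
    numDigits≡numDigitsFuel : ∀ m → numDigits p m ≡ numDigitsFuel m m
    numDigits≡numDigitsFuel zero = refl
    numDigits≡numDigitsFuel (suc m) with suc m | suc m / p
    ... | M | k = cong suc (go≡numDigitsFuel M m k)

    private
      go≡numDigitsFuel : ∀ M f k → _ ≡ numDigitsFuel f k
      go≡numDigitsFuel M zero    k       = refl
      go≡numDigitsFuel M (suc f) zero    = refl
      go≡numDigitsFuel M (suc f) (suc k) = cong suc (go≡numDigitsFuel M f (suc k / p))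

  mutual
    valuation≡valuationFuel : ∀ m → valuation p m ≡ valuationFuel m m
    valuation≡valuationFuel zero = refl
    valuation≡valuationFuel (suc m) with suc m % p ≟ 0
    ... | no  _ = refl
    ... | yes _ with suc m | suc m / p
    ...   | M | k = cong suc (go≡valuationFuel M m k)

    private
      go≡valuationFuel : ∀ M f k → _ ≡ valuationFuel f k
      go≡valuationFuel M zero    k       = refl
      go≡valuationFuel M (suc f) zero    = refl
      go≡valuationFuel M (suc f) (suc k) with suc k % p ≟ 0
      ... | yes _ = cong suc (go≡valuationFuel M f (suc k / p))
      ... | no  _ = refl

  digitSum-step : ∀ m → digitSum p m ≡ m % p + digitSum p (m / p)
  digitSum-step zero    = refl
  digitSum-step (suc m) = begin
    digitSum p (suc m)                               ≡⟨ digitSum≡digitSumFuel (suc m) ⟩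
    suc m % p + digitSumFuel m (suc m / p)           ≡⟨ cong (suc m % p +_) (irrelevant m _ ([1+k]/p≤k m) ≤-refl) ⟩
    suc m % p + digitSumFuel (suc m / p) (suc m / p) ≡⟨ cong (suc m % p +_) (digitSum≡digitSumFuel (suc m / p)) ⟨
    suc m % p + digitSum p (suc m / p)               ∎
    where
    open ≡-Reasoning
    fuel-zero : ∀ f → digitSumFuel f 0 ≡ 0
    fuel-zero zero    = refl
    fuel-zero (suc f) = fuel-zero f
    irrelevant : ∀ f g {k} → k ≤ f → k ≤ g → digitSumFuel f k ≡ digitSumFuel g k
    irrelevant f g {zero} _ _ = trans (fuel-zero f) (sym (fuel-zero g))
    irrelevant (suc f) (suc g) {suc k} (s≤s k≤f) (s≤s k≤g) = cong (suc k % p +_)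
      (irrelevant f g (≤-trans ([1+k]/p≤k k) k≤f) (≤-trans ([1+k]/p≤k k) k≤g))

  digitSum-≤ : ∀ m → digitSum p m ≤ m
  digitSum-≤ m = subst (_≤ m) (sym (digitSum≡digitSumFuel m)) (fuel-≤ m m)
    where
    fuel-≤ : ∀ f k → digitSumFuel f k ≤ k
    fuel-≤ zero    k = z≤n
    fuel-≤ (suc f) k = begin
      k % p + digitSumFuel f (k / p) ≤⟨ +-monoʳ-≤ (k % p) (fuel-≤ f (k / p)) ⟩
      k % p + k / p                  ≤⟨ +-monoʳ-≤ (k % p) (m≤m*n (k / p) p) ⟩
      k % p + k / p * p              ≡⟨ m≡m%n+[m/n]*n k p ⟨
      k                              ∎
      where open ≤-Reasoning

  digitSum-< : ∀ {m} → m < p → digitSum p m ≡ m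
  digitSum-< {m} m<p = begin
    digitSum p m                 ≡⟨ digitSum-step m ⟩
    m % p + digitSum p (m / p)   ≡⟨ cong₂ (λ r d → r + digitSum p d) (m<n⇒m%n≡m m<p) (m<n⇒m/n≡0 m<p) ⟩
    m + 0                        ≡⟨ +-identityʳ m ⟩
    m                            ∎
    where open ≡-Reasoning

  digitSum-+-p^* : ∀ k {a} b → a < p ^ k → digitSum p (a + p ^ k * b) ≡ digitSum p a + digitSum p b
  digitSum-+-p^* zero {zero} b _ = cong (digitSum p) (+-identityʳ b)
  digitSum-+-p^* zero {suc a} b (s≤s ())
  digitSum-+-p^* (suc k) {a} b a<p^k+1 = begin
    digitSum p (a + p ^ suc k * b)               ≡⟨ cong (λ x → digitSum p (a + x)) shift ⟩
    digitSum p (a + B * p)                       ≡⟨ digitSum-step (a + B * p) ⟩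
    (a + B * p) % p + digitSum p ((a + B * p) / p)
      ≡⟨ cong₂ (λ r d → r + digitSum p d) ([m+kn]%n≡m%n a B p) quotient ⟩
    a % p + digitSum p (a / p + p ^ k * b)       ≡⟨ cong (a % p +_) (digitSum-+-p^* k b a/p<p^k) ⟩
    a % p + (digitSum p (a / p) + digitSum p b)  ≡⟨ +-assoc (a % p) _ _ ⟨
    a % p + digitSum p (a / p) + digitSum p b    ≡⟨ cong (_+ digitSum p b) (digitSum-step a) ⟨
    digitSum p a + digitSum p b                  ∎
    where
    open ≡-Reasoning
    B = p ^ k * b
    shift : p ^ suc k * b ≡ B * p
    shift = trans (*-assoc p (p ^ k) b) (*-comm p B)
    quotient : (a + B * p) / p ≡ a / p + p ^ k * b
    quotient = trans (+-distrib-/-∣ʳ a (divides B refl)) (cong (a / p +_) (m*n/n≡m B p))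
    a/p<p^k : a / p < p ^ k
    a/p<p^k = m<n*o⇒m/o<n (subst (a <_) (*-comm p (p ^ k)) a<p^k+1)

  <p^numDigits : ∀ N → N < p ^ numDigits p N
  <p^numDigits N = subst (λ d → N < p ^ d) (sym (numDigits≡numDigitsFuel N)) (fuel-< N N ≤-refl)
    where
    fuel-< : ∀ f k → k ≤ f → k < p ^ numDigitsFuel f k
    fuel-< zero    zero    _         = s≤s z≤n
    fuel-< (suc f) zero    _         = s≤s z≤n
    fuel-< (suc f) (suc k) (s≤s k≤f) = begin-strict
      suc k                    ≡⟨ m≡m%n+[m/n]*n (suc k) p ⟩
      suc k % p + x * p        <⟨ +-monoˡ-< (x * p) (m%n<n (suc k) p) ⟩
      p + x * p                ≡⟨ *-comm (suc x) p ⟩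
      p * suc x                ≤⟨ *-monoʳ-≤ p (fuel-< f x (≤-trans ([1+k]/p≤k k) k≤f)) ⟩
      p * p ^ numDigitsFuel f x ∎
      where
      open ≤-Reasoning
      x = suc k / p

  p^numDigits≤ : ∀ N → 1 ≤ N → p ^ numDigits p N ≤ p * N
  p^numDigits≤ N 1≤N = subst (λ d → p ^ d ≤ p * N) (sym (numDigits≡numDigitsFuel N)) (fuel-≤ N N 1≤N ≤-refl)
    where
    fuel-zero : ∀ f → numDigitsFuel f 0 ≡ 0
    fuel-zero zero    = refl
    fuel-zero (suc f) = refl
    fuel-≤ : ∀ f k → 1 ≤ k → k ≤ f → p ^ numDigitsFuel f k ≤ p * k
    fuel-≤ (suc f) (suc k) _ (s≤s k≤f) with suc k / p in eq
    ... | zero  = *-monoʳ-≤ p (subst (λ d → p ^ d ≤ suc k) (sym (fuel-zero f)) (s≤s z≤n))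
    ... | suc x = *-monoʳ-≤ p (begin
      p ^ numDigitsFuel f (suc x) ≤⟨ fuel-≤ f (suc x) (s≤s z≤n) (subst (_≤ f) eq (≤-trans ([1+k]/p≤k k) k≤f)) ⟩
      p * suc x                   ≡⟨ *-comm p (suc x) ⟩
      suc x * p                   ≡⟨ cong (_* p) eq ⟨
      suc k / p * p               ≤⟨ m/n*n≤m (suc k) p ⟩
      suc k                       ∎)
      where open ≤-Reasoning

  p^valuation∣ : ∀ m {j} → j ≤ valuation p m → p ^ j ∣ m
  p^valuation∣ m j≤v = fuel-∣ m m _ (subst (_ ≤_) (valuation≡valuationFuel m) j≤v)
    where
    fuel-∣ : ∀ f k j → j ≤ valuationFuel f k → p ^ j ∣ k
    fuel-∣ f k zero _ = divides k (sym (*-identityʳ k))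
    fuel-∣ (suc f) (suc k) (suc j) j<v with suc k % p ≟ 0
    ... | yes k%p≡0 = subst (p ^ suc j ∣_) (m*[n/m]≡n (m%n≡0⇒n∣m (suc k) p k%p≡0))
                        (*-monoʳ-∣ p (fuel-∣ f (suc k / p) j (s≤s⁻¹ j<v)))

  valuation-≤ : ∀ m → valuation p m ≤ m
  valuation-≤ m = subst (_≤ m) (sym (valuation≡valuationFuel m)) (fuel-≤ m m)
    where
    fuel-≤ : ∀ f k → valuationFuel f k ≤ k
    fuel-≤ zero    k       = z≤n
    fuel-≤ (suc f) zero    = z≤n
    fuel-≤ (suc f) (suc k) with suc k % p ≟ 0
    ... | yes _ = s≤s (≤-trans (fuel-≤ f (suc k / p)) ([1+k]/p≤k k))
    ... | no  _ = z≤n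

  valuation-¬∣ : ∀ {m} → ¬ p ∣ m → valuation p m ≡ 0
  valuation-¬∣ {zero}  _   = refl
  valuation-¬∣ {suc m} p∤m with suc m % p ≟ 0
  ... | yes m%p≡0 = contradiction (m%n≡0⇒n∣m (suc m) p m%p≡0) p∤m
  ... | no  _     = refl

module DigitSumDeviation (q : ℕ) .{{_ : NonZero q}} where
  open IntegerSums
  open Digits q
  open import Defs using (digitSum; numDigits)
  open import Data.Nat as ℕ using (zero; suc; z≤n; s≤s; _^_)
  import Data.Nat.Properties as ℕₚ
  open import Data.Integer using (+_; 0ℤ; 1ℤ; _+_; _*_; -_; _-_; _≤_; +≤+; nonNegative)
  open import Data.Integer.Properties
  open import Data.Integer.Tactic.RingSolver using (solve-∀)
  open import Data.Product using (_,_)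
  open import Relation.Binary.PropositionalEquality

  -- 2 s_p(m) minus its mean k(p−1) over m < p^k, doubled to stay integral.
  deviation : ℕ → ℕ → ℤ
  deviation k m = + 2 * + digitSum p m - + k * + q

  centredDigit : ℕ → ℤ
  centredDigit i = + 2 * + i - + q

  squaredDeviation : ℕ → ℤ
  squaredDeviation k = ∑[ m < p ^ k ] deviation k m * deviation k m

  ∑-centredDigit : ∑[ i < p ] centredDigit i ≡ 0ℤ
  ∑-centredDigit = begin
    ∑[ i < p ] (+ 2 * + i - + q)               ≡⟨ sumℤ-cong p (λ {i} _ → shift (+ i) (+ q)) ⟩
    ∑[ i < p ] (+ 2 * + i + 1ℤ + - + p)         ≡⟨ sumℤ-+ p (λ i → + 2 * + i + 1ℤ) (λ _ → - + p) ⟩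
    (∑[ i < p ] (+ 2 * + i + 1ℤ)) + (∑[ i < p ] - + p) ≡⟨ cong₂ _+_ (∑-odd p) (sumℤ-const p (- + p)) ⟩
    + p * + p + + p * - + p                    ≡⟨ cancel (+ p) ⟩
    0ℤ                                         ∎
    where
    open ≡-Reasoning
    shift : ∀ i q → + 2 * i - q ≡ + 2 * i + 1ℤ + - (1ℤ + q)
    shift = solve-∀
    cancel : ∀ n → n * n + n * (- n) ≡ 0ℤ
    cancel = solve-∀

  centredDigit²≤ : ∀ {i} → i ℕ.< p → centredDigit i * centredDigit i ≤ + q * + q
  centredDigit²≤ {i} (s≤s i≤q) with ℕₚ.m≤n⇒∃[o]m+o≡n i≤q
  ... | r , refl = 0≤i-j⇒j≤i (subst (0ℤ ≤_) (sym (gap (+ i) (+ r)))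
                     (*-nonNeg {+ 4 * + i} (*-nonNeg {+ 4} {+ i} (+≤+ z≤n) (+≤+ z≤n)) (+≤+ z≤n)))
    where
    gap : ∀ i r → (i + r) * (i + r) - (+ 2 * i - (i + r)) * (+ 2 * i - (i + r)) ≡ + 4 * i * r
    gap = solve-∀

  deviation-+-p^* : ∀ k {i j} → i ℕ.< p → j ℕ.< p ^ k →
    deviation (suc k) (i ℕ.* p ^ k ℕ.+ j) ≡ deviation k j + centredDigit i
  deviation-+-p^* k {i} {j} i<p j<p^k = begin
    + 2 * + digitSum p (i ℕ.* p ^ k ℕ.+ j) - + suc k * + q
      ≡⟨ cong (λ m → + 2 * + digitSum p m - + suc k * + q) (swap i j) ⟩
    + 2 * + digitSum p (j ℕ.+ p ^ k ℕ.* i) - + suc k * + q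
      ≡⟨ cong (λ s → + 2 * + s - + suc k * + q) (trans (digitSum-+-p^* k i j<p^k) (cong (digitSum p j ℕ.+_) (digitSum-< i<p))) ⟩
    + 2 * (+ digitSum p j + + i) - (1ℤ + + k) * + q
      ≡⟨ regroup (+ digitSum p j) (+ i) (+ k) (+ q) ⟩
    deviation k j + centredDigit i ∎
    where
    open ≡-Reasoning
    swap : ∀ i j → i ℕ.* p ^ k ℕ.+ j ≡ j ℕ.+ p ^ k ℕ.* i
    swap i j = trans (ℕₚ.+-comm (i ℕ.* p ^ k) j) (cong (j ℕ.+_) (ℕₚ.*-comm i (p ^ k)))
    regroup : ∀ s i k q → + 2 * (s + i) - (1ℤ + k) * q ≡ (+ 2 * s - k * q) + (+ 2 * i - q)
    regroup = solve-∀

  squaredDeviation-step : ∀ k →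
    squaredDeviation (suc k) ≡ + p * squaredDeviation k + + (p ^ k) * (∑[ i < p ] centredDigit i * centredDigit i)
  squaredDeviation-step k = begin
    squaredDeviation (suc k)
      ≡⟨ sumℤ-blocks p P (λ m → deviation (suc k) m * deviation (suc k) m) ⟩
    ∑[ i < p ] ∑[ j < P ] deviation (suc k) (i ℕ.* P ℕ.+ j) * deviation (suc k) (i ℕ.* P ℕ.+ j)
      ≡⟨ sumℤ-cong p (λ i<p → sumℤ-cong P (λ j<P → cong (λ d → d * d) (shift i<p j<P))) ⟩
    ∑[ i < p ] ∑[ j < P ] (1ℤ * u j + t i) * (1ℤ * u j + t i)
      ≡⟨ sumℤ-cong p (λ {i} _ → trans (sumℤ-affine² P 1ℤ (t i) u) (collect (squaredDeviation k) (sumℤ P u) (+ P) (t i))) ⟩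
    ∑[ i < p ] ((+ 2 * sumℤ P u) * t i + + P * (t i * t i) + squaredDeviation k)
      ≡⟨ sumℤ-+ p _ (λ _ → squaredDeviation k) ⟩
    (∑[ i < p ] ((+ 2 * sumℤ P u) * t i + + P * (t i * t i))) + (∑[ i < p ] squaredDeviation k)
      ≡⟨ cong₂ _+_ (sumℤ-linear p (+ 2 * sumℤ P u) (+ P) t _) (sumℤ-const p (squaredDeviation k)) ⟩
    (+ 2 * sumℤ P u) * (∑[ i < p ] t i) + + P * T + + p * squaredDeviation k
      ≡⟨ cong (λ z → (+ 2 * sumℤ P u) * z + + P * T + + p * squaredDeviation k) ∑-centredDigit ⟩
    (+ 2 * sumℤ P u) * 0ℤ + + P * T + + p * squaredDeviation k
      ≡⟨ drop (+ 2 * sumℤ P u) (+ P * T) (+ p * squaredDeviation k) ⟩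
    + p * squaredDeviation k + + P * T ∎
    where
    open ≡-Reasoning
    P = p ^ k
    t = centredDigit
    u = deviation k
    T = ∑[ i < p ] t i * t i
    shift : ∀ {i j} → i ℕ.< p → j ℕ.< P → deviation (suc k) (i ℕ.* P ℕ.+ j) ≡ 1ℤ * u j + t i
    shift {i} {j} i<p j<P = trans (deviation-+-p^* k i<p j<P) (cong (_+ t i) (sym (*-identityˡ (u j))))
    collect : ∀ W U P t → 1ℤ * 1ℤ * W + + 2 * 1ℤ * t * U + P * (t * t) ≡ (+ 2 * U) * t + P * (t * t) + W
    collect = solve-∀
    drop : ∀ a b c → a * 0ℤ + b + c ≡ c + b
    drop = solve-∀

  squaredDeviation-≤ : ∀ k → squaredDeviation k ≤ + k * + (p ^ k) * (+ q * + q)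
  squaredDeviation-≤ zero    = ≤-refl
  squaredDeviation-≤ (suc k) = begin
    squaredDeviation (suc k)                       ≡⟨ squaredDeviation-step k ⟩
    + p * squaredDeviation k + + P * T             ≤⟨ +-mono-≤ (*-monoˡ-≤-nonNeg (+ p) (squaredDeviation-≤ k))
                                                                (*-monoˡ-≤-nonNeg (+ P) T≤) ⟩
    + p * (+ k * + P * q²) + + P * (+ p * q²)      ≡⟨ collect (+ p) (+ k) (+ P) q² ⟩
    (1ℤ + + k) * (+ p * + P) * q²                  ≡⟨ cong (λ z → (1ℤ + + k) * z * q²) (pos-* p P) ⟨
    + suc k * + (p ℕ.* P) * q²                     ∎
    where
    open ≤-Reasoning
    P = p ^ k
    q² = + q * + q
    T = ∑[ i < p ] centredDigit i * centredDigit i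
    T≤ : T ≤ + p * q²
    T≤ = ≤-trans (sumℤ-mono-≤ p centredDigit²≤) (≤-reflexive (sumℤ-const p q²))
    collect : ∀ p k P q² → p * (k * P * q²) + P * (p * q²) ≡ (1ℤ + k) * (p * P) * q²
    collect = solve-∀

  deviation-multiples-≤ : ∀ k c {N} → N ℕ.≤ p ^ k →
    ∑[ n < N ] deviation k (suc c ℕ.* n) * deviation k (suc c ℕ.* n)
      ≤ + suc c * (+ 2 * squaredDeviation k + + (p ^ k) * (+ 8 * (+ suc c * + suc c)))
  deviation-multiples-≤ k c {N} N≤M = begin
    ∑[ n < N ] f (C ℕ.* n)                    ≤⟨ sumℤ-monoˡ-≤ (λ n → f (C ℕ.* n)) (λ n → 0≤f (C ℕ.* n)) N≤M ⟩
    ∑[ n < M ] f (C ℕ.* n)                    ≡⟨ sumℤ-cong M (λ {n} _ → cong f (ℕₚ.*-comm C n)) ⟩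
    ∑[ n < M ] f (n ℕ.* C)                    ≤⟨ sumℤ-multiples-≤ M c f 0≤f ⟩
    sumℤ (M ℕ.* C) f                          ≡⟨ cong (λ L → sumℤ L f) (ℕₚ.*-comm M C) ⟩
    sumℤ (C ℕ.* M) f                          ≡⟨ sumℤ-blocks C M f ⟩
    ∑[ i < C ] ∑[ j < M ] f (i ℕ.* M ℕ.+ j)   ≤⟨ sumℤ-mono-≤ C (λ i<C → sumℤ-mono-≤ M (λ j<M → split i<C j<M)) ⟩
    ∑[ i < C ] ∑[ j < M ] (+ 2 * f j + c²)   ≡⟨ sumℤ-cong C (λ _ → block) ⟩
    ∑[ i < C ] (+ 2 * squaredDeviation k + + M * c²) ≡⟨ sumℤ-const C _ ⟩
    + C * (+ 2 * squaredDeviation k + + M * c²) ∎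
    where
    open ≤-Reasoning
    C = suc c
    M = p ^ k
    c² = + 8 * (+ C * + C)
    f : ℕ → ℤ
    f m = deviation k m * deviation k m
    0≤f : ∀ m → 0ℤ ≤ f m
    0≤f m = square-nonNeg (deviation k m)
    block : ∑[ j < M ] (+ 2 * f j + c²) ≡ + 2 * squaredDeviation k + + M * c²
    block = trans (sumℤ-+ M _ (λ _ → c²)) (cong₂ _+_ (sumℤ-*ˡ M (+ 2) f) (sumℤ-const M c²))
    shift : ∀ {i j} → j ℕ.< M → deviation k (i ℕ.* M ℕ.+ j) ≡ deviation k j + + 2 * + digitSum p i
    shift {i} {j} j<M = begin-equality
      + 2 * + digitSum p (i ℕ.* M ℕ.+ j) - + k * + q
        ≡⟨ cong (λ m → + 2 * + digitSum p m - + k * + q)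
             (trans (ℕₚ.+-comm (i ℕ.* M) j) (cong (j ℕ.+_) (ℕₚ.*-comm i M))) ⟩
      + 2 * + digitSum p (j ℕ.+ M ℕ.* i) - + k * + q
        ≡⟨ cong (λ s → + 2 * + s - + k * + q) (digitSum-+-p^* k i j<M) ⟩
      + 2 * (+ digitSum p j + + digitSum p i) - + k * + q
        ≡⟨ regroup (+ digitSum p j) (+ digitSum p i) (+ k * + q) ⟩
      deviation k j + + 2 * + digitSum p i ∎
      where
      regroup : ∀ s t kq → + 2 * (s + t) - kq ≡ (+ 2 * s - kq) + + 2 * t
      regroup = solve-∀
    split : ∀ {i j} → i ℕ.< C → j ℕ.< M → f (i ℕ.* M ℕ.+ j) ≤ + 2 * f j + c²
    split {i} {j} i<C j<M = begin
      f (i ℕ.* M ℕ.+ j)                          ≡⟨ cong (λ d → d * d) (shift {i} j<M) ⟩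
      (deviation k j + s₂) * (deviation k j + s₂) ≤⟨ square-+-≤ (deviation k j) s₂ ⟩
      + 2 * f j + + 2 * (s₂ * s₂)                ≤⟨ +-monoʳ-≤ (+ 2 * f j) (*-monoˡ-≤-nonNeg (+ 2) s₂²≤) ⟩
      + 2 * f j + + 2 * (+ 4 * (+ C * + C))      ≡⟨ cong (_+_ (+ 2 * f j)) (*-assoc (+ 2) (+ 4) (+ C * + C)) ⟨
      + 2 * f j + c²                             ∎
      where
      s₂ = + 2 * + digitSum p i
      s≤C : digitSum p i ℕ.≤ C
      s≤C = ℕₚ.≤-trans (digitSum-≤ i) (ℕₚ.<⇒≤ i<C)
      s₂²≤ : s₂ * s₂ ≤ + 4 * (+ C * + C)
      s₂²≤ = subst (_≤ + 4 * (+ C * + C)) (regroup (+ digitSum p i)) (*-monoˡ-≤-nonNeg (+ 4) (square-mono s≤C))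
        where
        regroup : ∀ s → + 4 * (s * s) ≡ (+ 2 * s) * (+ 2 * s)
        regroup = solve-∀

  digitSum-deviation-≤ : ∀ c N → 1 ℕ.≤ N →
    let k = numDigits p N in
    ∑[ n < N ] deviation k (suc c ℕ.* n) * deviation k (suc c ℕ.* n)
      ≤ + N * + k * (+ p * + suc c * (+ 2 * (+ q * + q) + + 8 * (+ suc c * + suc c)))
  digitSum-deviation-≤ c N@(suc m) 1≤N = begin
    ∑[ n < N ] deviation k (C ℕ.* n) * deviation k (C ℕ.* n)
      ≤⟨ deviation-multiples-≤ k c (ℕₚ.<⇒≤ (<p^numDigits N)) ⟩
    + C * (+ 2 * squaredDeviation k + + M * c²)
      ≤⟨ *-monoˡ-≤-nonNeg (+ C) (+-mono-≤ (*-monoˡ-≤-nonNeg (+ 2) (squaredDeviation-≤ k))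
                                          (*-monoʳ-≤-nonNeg c² ⦃ nonNegative 0≤c² ⦄ M≤kM)) ⟩
    + C * (+ 2 * (+ k * + M * q²) + + k * + M * c²)
      ≡⟨ collect (+ C) (+ k) (+ M) q² c² ⟩
    + M * (+ k * (+ C * (+ 2 * q² + c²)))
      ≤⟨ *-monoʳ-≤-nonNeg (+ k * (+ C * (+ 2 * q² + c²))) ⦃ nonNegative 0≤rest ⦄ M≤pN ⟩
    + p * + N * (+ k * (+ C * (+ 2 * q² + c²)))
      ≡⟨ reorder (+ p) (+ N) (+ k) (+ C) (+ 2 * q² + c²) ⟩
    + N * + k * (+ p * + C * (+ 2 * q² + c²)) ∎
    where
    open ≤-Reasoning
    C = suc c
    k = numDigits p N
    M = p ^ k
    q² = + q * + q
    c² = + 8 * (+ C * + C)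
    0≤c² : 0ℤ ≤ c²
    0≤c² = *-nonNeg {+ 8} (+≤+ z≤n) (square-nonNeg (+ C))
    0≤rest : 0ℤ ≤ + k * (+ C * (+ 2 * q² + c²))
    0≤rest = *-nonNeg {+ k} (+≤+ z≤n) (*-nonNeg {+ C} (+≤+ z≤n)
               (+-mono-≤ (*-nonNeg {+ 2} (+≤+ z≤n) (square-nonNeg (+ q))) 0≤c²))
    M≤kM : + M ≤ + k * + M
    M≤kM = subst (_≤ + k * + M) (*-identityˡ (+ M)) (*-monoʳ-≤-nonNeg (+ M) (+≤+ 1≤k))
      where
      1≤k : 1 ℕ.≤ k
      1≤k = s≤s z≤n
    M≤pN : + M ≤ + p * + N
    M≤pN = subst (+ M ≤_) (pos-* p N) (+≤+ (p^numDigits≤ N 1≤N))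
    collect : ∀ C k M q² c² → C * (+ 2 * (k * M * q²) + k * M * c²) ≡ M * (k * (C * (+ 2 * q² + c²)))
    collect = solve-∀
    reorder : ∀ p N k C r → p * N * (k * (C * r)) ≡ N * k * (p * C * r)
    reorder = solve-∀

module ValuationMoment (q : ℕ) .{{_ : NonZero q}} (p-prime : Prime (suc q)) where
  open IntegerSums
  open Counting
  open Digits q
  open import Defs using (valuation)
  open import Data.Nat as ℕ using (zero; suc; z≤n; s≤s; _^_; _∸_)
  import Data.Nat.Properties as ℕₚ
  open import Data.Nat.Divisibility as ℕ∣ using (divides; _∣?_)
  open import Data.Nat.Primality using (euclidsLemma)
  open import Data.Integer using (+_; 0ℤ; 1ℤ; _+_; _*_; _-_; _≤_; +≤+; ∣_∣; _⊖_)
  open import Data.Integer.Properties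
  import Data.Integer.Divisibility as ℤ∣
  import Data.Integer.Divisibility.Signed as ℤ∣ₛ
  open import Data.Integer.Tactic.RingSolver using (solve-∀)
  open import Data.Product using (_×_; _,_)
  open import Data.Sum using (inj₁; inj₂)
  open import Relation.Nullary using (¬_; yes; no; contradiction)
  open import Relation.Binary.PropositionalEquality

  p^i∣m*n⇒p^i∣n : ∀ {m} → ¬ p ℕ∣.∣ m → ∀ i n → p ^ i ℕ∣.∣ m ℕ.* n → p ^ i ℕ∣.∣ n
  p^i∣m*n⇒p^i∣n p∤m zero    n _ = ℕ∣.1∣ n
  p^i∣m*n⇒p^i∣n {m} p∤m (suc i) n p^i+1∣mn with euclidsLemma m n p-prime (ℕ∣.∣-trans (ℕ∣.m∣m*n (p ^ i)) p^i+1∣mn)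
  ... | inj₁ p∣m = contradiction p∣m p∤m
  ... | inj₂ (divides y refl) = subst (p ℕ.* p ^ i ℕ∣.∣_) (ℕₚ.*-comm p y)
        (ℕ∣.*-monoʳ-∣ p (p^i∣m*n⇒p^i∣n p∤m i y (ℕ∣.*-cancelˡ-∣ p (subst (p ℕ.* p ^ i ℕ∣.∣_) regroup p^i+1∣mn))))
    where
    regroup : m ℕ.* (y ℕ.* p) ≡ p ℕ.* (m ℕ.* y)
    regroup = trans (sym (ℕₚ.*-assoc m y p)) (ℕₚ.*-comm (m ℕ.* y) p)

  module _ (E : ℕ) (F : ℤ) (z≢0 : ∀ n → + E * + n + F ≢ 0ℤ) where

    z : ℕ → ℤ
    z n = + E * + n + F

    ∣z∣≤ : ∀ {n N} → n ℕ.≤ N → ∣ z n ∣ ℕ.≤ E ℕ.* N ℕ.+ ∣ F ∣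
    ∣z∣≤ {n} {N} n≤N = begin
      ∣ + E * + n + F ∣           ≤⟨ ∣i+j∣≤∣i∣+∣j∣ (+ E * + n) F ⟩
      ∣ + E * + n ∣ ℕ.+ ∣ F ∣      ≡⟨ cong (ℕ._+ ∣ F ∣) (abs-* (+ E) (+ n)) ⟩
      E ℕ.* n ℕ.+ ∣ F ∣            ≤⟨ ℕₚ.+-monoˡ-≤ ∣ F ∣ (ℕₚ.*-monoʳ-≤ E n≤N) ⟩
      E ℕ.* N ℕ.+ ∣ F ∣            ∎
      where open ℕₚ.≤-Reasoning

    z-difference : ∀ {h n} → h ℕ.≤ n → z n - z h ≡ + (E ℕ.* (n ∸ h))
    z-difference {h} {n} h≤n = begin
      z n - z h                           ≡⟨ cancel (+ E) (+ n) (+ h) F ⟩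
      + E * + n - + E * + h                ≡⟨ cong₂ _-_ (pos-* E n) (pos-* E h) ⟨
      + (E ℕ.* n) - + (E ℕ.* h)            ≡⟨ m-n≡m⊖n (E ℕ.* n) (E ℕ.* h) ⟩
      E ℕ.* n ⊖ E ℕ.* h                    ≡⟨ ⊖-≥ (ℕₚ.*-monoʳ-≤ E h≤n) ⟩
      + (E ℕ.* n ∸ E ℕ.* h)                ≡⟨ cong +_ (ℕₚ.*-distribˡ-∸ E n h) ⟨
      + (E ℕ.* (n ∸ h))                    ∎
      where
      open ≡-Reasoning
      cancel : ∀ E n h F → (E * n + F) - (E * h + F) ≡ E * n - E * h
      cancel = solve-∀

    -- When p ∤ E, the solutions of E n + F ≡ 0 (mod p^i) form a single residue class mod p^i.
    spaced : ¬ p ℕ∣.∣ E → ∀ i {h n} → h ℕ.< n →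
      p ^ i ℕ∣.∣ ∣ z h ∣ → p ^ i ℕ∣.∣ ∣ z n ∣ → h ℕ.+ p ^ i ℕ.≤ n
    spaced p∤E i {h} {n} h<n p^i∣zh p^i∣zn = begin
      h ℕ.+ p ^ i        ≤⟨ ℕₚ.+-monoʳ-≤ h (ℕ∣.∣⇒≤ ⦃ ℕ.>-nonZero (ℕₚ.m<n⇒0<n∸m h<n) ⦄ p^i∣n∸h) ⟩
      h ℕ.+ (n ∸ h)      ≡⟨ ℕₚ.m+[n∸m]≡n (ℕₚ.<⇒≤ h<n) ⟩
      n                  ∎
      where
      open ℕₚ.≤-Reasoning
      p^i∣difference : + (p ^ i) ℤ∣ₛ.∣ z n - z h
      p^i∣difference = ℤ∣ₛ.∣m∣n⇒∣m-n (ℤ∣ₛ.∣ᵤ⇒∣ {+ (p ^ i)} {z n} p^i∣zn)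
                                     (ℤ∣ₛ.∣ᵤ⇒∣ {+ (p ^ i)} {z h} p^i∣zh)
      p^i∣n∸h : p ^ i ℕ∣.∣ n ∸ h
      p^i∣n∸h = p^i∣m*n⇒p^i∣n p∤E i (n ∸ h)
        (ℤ∣ₛ.∣⇒∣ᵤ (subst (+ (p ^ i) ℤ∣ₛ.∣_) (z-difference (ℕₚ.<⇒≤ h<n)) p^i∣difference))

    v : ℕ → ℕ
    v n = valuation p ∣ z n ∣

    ∑-valuation²-≤ : ¬ ((+ p ℤ∣.∣ + E) × (+ p ℤ∣.∣ F)) → ∀ N →
      ∑[ n < N ] + v n * + v n ≤ + 3 * + (N ℕ.+ (E ℕ.* N ℕ.+ ∣ F ∣))
    ∑-valuation²-≤ p∤gcd N with p ∣? E
    ... | yes p∣E = subst (_≤ + 3 * + A) (sym ∑≡0) (*-nonNeg {+ 3} {+ A} (+≤+ z≤n) (+≤+ z≤n))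
      where
      v≡0 : ∀ n → v n ≡ 0
      v≡0 n = valuation-¬∣ λ p∣zn → p∤gcd (p∣E , ℤ∣ₛ.∣⇒∣ᵤ
        (ℤ∣ₛ.∣m+n∣m⇒∣n (ℤ∣ₛ.∣ᵤ⇒∣ {+ p} {z n} p∣zn) (ℤ∣ₛ.∣m⇒∣m*n (+ n) (ℤ∣ₛ.∣ᵤ⇒∣ {+ p} {+ E} p∣E))))
      A = N ℕ.+ (E ℕ.* N ℕ.+ ∣ F ∣)
      ∑≡0 : ∑[ n < N ] + v n * + v n ≡ 0ℤ
      ∑≡0 = trans (sumℤ-cong N (λ {n} _ → cong (λ x → + x * + x) (v≡0 n))) (trans (sumℤ-const N 0ℤ) (*-zeroʳ (+ N)))
    ... | no p∤E = begin
      ∑[ n < N ] + v n * + v n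
        ≤⟨ sumℤ-mono-≤ N (λ n<N → square≤∑odd _ (v≤A n<N) (hit n<N) (λ _ → indicator-nonNeg _)) ⟩
      ∑[ n < N ] ∑[ j < A ] w j * hits j n
        ≡⟨ sumℤ-comm N A (λ n j → w j * hits j n) ⟩
      ∑[ j < A ] ∑[ n < N ] w j * hits j n
        ≡⟨ sumℤ-cong A (λ {j} _ → trans (sumℤ-*ˡ N (w j) (hits j)) (cong (w j *_) (sumℤ-indicator (P? j) N))) ⟩
      ∑[ j < A ] w j * + count (P? j) N
        ≤⟨ ∑-odd-weights-≤ A (λ j → + count (P? j) N) (+≤+ z≤n) count≤ ⟩
      + 3 * + A ∎
      where
      open ≤-Reasoning
      L = E ℕ.* N ℕ.+ ∣ F ∣
      A = N ℕ.+ L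
      w : ℕ → ℤ
      w j = + 2 * + j + 1ℤ
      P? : ∀ j n → _
      P? j n = p ^ suc j ∣? ∣ z n ∣
      hits : ℕ → ℕ → ℤ
      hits j n = indicator (P? j n)
      v≤A : ∀ {n} → n ℕ.< N → v n ℕ.≤ A
      v≤A n<N = ℕₚ.≤-trans (valuation-≤ _) (ℕₚ.≤-trans (∣z∣≤ (ℕₚ.<⇒≤ n<N)) (ℕₚ.m≤n+m L N))
      hit : ∀ {n} → n ℕ.< N → ∀ {j} → j ℕ.< v n → hits j n ≡ 1ℤ
      hit {n} _ {j} j<v = indicator-yes (P? j n) (p^valuation∣ ∣ z n ∣ j<v)
      count≤ : ∀ j → + (2 ^ suc j) * + count (P? j) N ≤ + A
      count≤ j = subst (_≤ + A) (pos-* (2 ^ suc j) _) (+≤+ (ℕₚ.≤-trans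
        (ℕₚ.*-monoˡ-≤ (count (P? j) N) (ℕₚ.^-monoˡ-≤ (suc j) (s≤s (ℕ.>-nonZero⁻¹ q))))
        (count-≤ (P? j) (p ^ suc j) (spaced p∤E (suc j)) N L hit≤L)))
        where
        hit≤L : ∀ {n} → n ℕ.< N → p ^ suc j ℕ∣.∣ ∣ z n ∣ → p ^ suc j ℕ.≤ L
        hit≤L {n} n<N p^j+1∣zn = ℕₚ.≤-trans (ℕ∣.∣⇒≤ ⦃ ℕ.≢-nonZero ∣zn∣≢0 ⦄ p^j+1∣zn) (∣z∣≤ (ℕₚ.<⇒≤ n<N))
          where
          ∣zn∣≢0 : ∣ z n ∣ ≢ 0
          ∣zn∣≢0 ∣zn∣≡0 = z≢0 n (∣i∣≡0⇒i≡0 ∣zn∣≡0)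

module RationalCovariance where
  open IntegerSums
  open import Defs using (Cov; sumBelow)
  open import Data.Nat as ℕ using (suc)
  open import Data.Integer as ℤ using (+_)
  import Data.Integer.Properties as ℤₚ
  open import Data.Integer.Tactic.RingSolver using (solve-∀)
  open import Data.Rational as ℚ using (toℚᵘ) renaming (_≤_ to _≤ℚ_; _*_ to _*ℚ_; _/_ to _/ℚ_)
  import Data.Rational.Properties as ℚₚ
  open import Data.Rational.Unnormalised as ℚᵘ using (ℚᵘ; mkℚᵘ; *≤*; ↥_; ↧_)
  import Data.Rational.Unnormalised.Properties as ℚᵘₚ
  open import Relation.Binary.PropositionalEquality

  -- Cov N X Y = covSum N X Y / N²; the inequality is checked on numerators and denominators in ℚᵘ.
  Cov²-≤ : ∀ m X Y K → let N = suc m; S = covSum N (λ n → + X n) (λ n → + Y n) in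
    S ℤ.* S ℤ.≤ + K ℤ.* (+ N ℤ.* + N ℤ.* + N ℤ.* + N) → Cov N X Y *ℚ Cov N X Y ≤ℚ + K /ℚ 1
  Cov²-≤ m X Y K S²≤ = ℚₚ.toℚᵘ-cancel-≤
    (ℚᵘₚ.≤-respʳ-≃ (ℚᵘₚ.≃-sym (toℚᵘ-/ (+ K) 0)) (ℚᵘₚ.≤-respˡ-≃ (ℚᵘₚ.≃-sym Cov²≃) Q²≤))
    where
    N = suc m
    n = + N
    A = sumBelow N (λ i → X i ℕ.* Y i)
    B = sumBelow N X
    C = sumBelow N Y
    S = covSum N (λ i → + X i) (λ i → + Y i)
    toℚᵘ-/ : ∀ i m → toℚᵘ (i /ℚ suc m) ℚᵘ.≃ mkℚᵘ i m
    toℚᵘ-/ i m = ℚₚ.toℚᵘ-fromℚᵘ (mkℚᵘ i m)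
    Q : ℚᵘ
    Q = mkℚᵘ (+ A) m ℚᵘ.- mkℚᵘ (+ B) m ℚᵘ.* mkℚᵘ (+ C) m
    Cov≃ : toℚᵘ (Cov N X Y) ℚᵘ.≃ Q
    Cov≃ = ℚᵘₚ.≃-trans (ℚᵘₚ.≃-trans (ℚₚ.toℚᵘ-homo-+ a (ℚ.- (b *ℚ c))) (ℚᵘₚ.+-congʳ (toℚᵘ a) (ℚₚ.toℚᵘ-homo‿- (b *ℚ c))))
             (ℚᵘₚ.+-cong (toℚᵘ-/ (+ A) m) (ℚᵘₚ.-‿cong bc≃))
      where
      a = + A /ℚ N
      b = + B /ℚ N
      c = + C /ℚ N
      bc≃ : toℚᵘ (b *ℚ c) ℚᵘ.≃ mkℚᵘ (+ B) m ℚᵘ.* mkℚᵘ (+ C) m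
      bc≃ = ℚᵘₚ.≃-trans (ℚₚ.toℚᵘ-homo-* b c) (ℚᵘₚ.*-cong (toℚᵘ-/ (+ B) m) (toℚᵘ-/ (+ C) m))
    Cov²≃ : toℚᵘ (Cov N X Y *ℚ Cov N X Y) ℚᵘ.≃ Q ℚᵘ.* Q
    Cov²≃ = ℚᵘₚ.≃-trans (ℚₚ.toℚᵘ-homo-* (Cov N X Y) (Cov N X Y)) (ℚᵘₚ.*-cong Cov≃ Cov≃)
    S≡ : S ≡ n ℤ.* + A ℤ.- + B ℤ.* + C
    S≡ = cong₂ (λ s t → n ℤ.* s ℤ.- t)
           (sym (trans (sumBelow≡sumℤ N (λ i → X i ℕ.* Y i)) (sumℤ-cong N (λ {i} _ → ℤₚ.pos-* (X i) (Y i)))))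
           (sym (cong₂ ℤ._*_ (sumBelow≡sumℤ N X) (sumBelow≡sumℤ N Y)))
    ↥Q : ↥ Q ≡ n ℤ.* S
    ↥Q = trans (cong (λ n² → + A ℤ.* n² ℤ.+ ℤ.- (+ B ℤ.* + C) ℤ.* n) (ℤₚ.pos-* N N))
           (trans (numerator (+ A) (+ B) (+ C) n) (cong (n ℤ.*_) (sym S≡)))
      where
      numerator : ∀ a b c n → a ℤ.* (n ℤ.* n) ℤ.+ ℤ.- (b ℤ.* c) ℤ.* n ≡ n ℤ.* (n ℤ.* a ℤ.- b ℤ.* c)
      numerator = solve-∀
    ↧Q² : ↧ (Q ℚᵘ.* Q) ≡ n ℤ.* n ℤ.* n ℤ.* (n ℤ.* n ℤ.* n)
    ↧Q² = trans (ℤₚ.pos-* N³ N³) (cong₂ ℤ._*_ n³ n³)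
      where
      N³ = N ℕ.* (N ℕ.* N)
      n³ : + N³ ≡ n ℤ.* n ℤ.* n
      n³ = trans (ℤₚ.pos-* N (N ℕ.* N)) (trans (cong (n ℤ.*_) (ℤₚ.pos-* N N)) (sym (ℤₚ.*-assoc n n n)))
    Q²≤ : Q ℚᵘ.* Q ℚᵘ.≤ mkℚᵘ (+ K) 0
    Q²≤ = *≤* (begin
      ↥ Q ℤ.* ↥ Q ℤ.* + 1                  ≡⟨ cong (λ u → u ℤ.* u ℤ.* + 1) ↥Q ⟩
      n ℤ.* S ℤ.* (n ℤ.* S) ℤ.* + 1        ≡⟨ square n S ⟩
      n ℤ.* n ℤ.* (S ℤ.* S)                ≤⟨ ℤₚ.*-monoˡ-≤-nonNeg (n ℤ.* n) ⦃ ℤ.nonNegative (square-nonNeg n) ⦄ S²≤ ⟩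
      n ℤ.* n ℤ.* (+ K ℤ.* (n ℤ.* n ℤ.* n ℤ.* n)) ≡⟨ sixth (+ K) n ⟩
      + K ℤ.* (n ℤ.* n ℤ.* n ℤ.* (n ℤ.* n ℤ.* n)) ≡⟨ cong (+ K ℤ.*_) ↧Q² ⟨
      + K ℤ.* ↧ (Q ℚᵘ.* Q)                  ∎)
      where
      open ℤₚ.≤-Reasoning
      square : ∀ n S → n ℤ.* S ℤ.* (n ℤ.* S) ℤ.* + 1 ≡ n ℤ.* n ℤ.* (S ℤ.* S)
      square = solve-∀
      sixth : ∀ K n → n ℤ.* n ℤ.* (K ℤ.* (n ℤ.* n ℤ.* n ℤ.* n)) ≡ K ℤ.* (n ℤ.* n ℤ.* n ℤ.* (n ℤ.* n ℤ.* n))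
      sixth = solve-∀

open import Defs
open import Data.Nat using () renaming (_≤_ to _≤ℕ_; _*_ to _*ℕ_)
open import Data.Integer using (+_; ∣_∣; 0ℤ; +<+) renaming (_*_ to _*ℤ_; _+_ to _+ℤ_; _<_ to _<ℤ_)
open import Data.Integer.Divisibility using (_∣_)
open import Data.Rational using () renaming (_≤_ to _≤ℚ_; _*_ to _*ℚ_; _/_ to _/ℚ_)
open import Data.Product using (_×_; Σ; _,_)
open import Relation.Nullary using (¬_)
open import Relation.Binary.PropositionalEquality using (_≢_)

module CovarianceBound (q : ℕ) .{{_ : NonZero q}} (p-prime : Prime (suc q)) (c E : ℕ) (F : ℤ)
  (p∤gcd : ¬ ((+ suc q ∣ + E) × (+ suc q ∣ F))) (z≢0 : ∀ n → + E *ℤ + n +ℤ F ≢ 0ℤ) where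
  open IntegerSums
  open Digits q
  open DigitSumDeviation q
  open ValuationMoment q p-prime
  open import Data.Nat as ℕ using (z≤n)
  import Data.Nat.Properties as ℕₚ
  import Data.Nat.Tactic.RingSolver as ℕ-Ring
  open import Data.Integer as ℤ using (0ℤ; _+_; _*_; -_; _-_; _≤_; +≤+)
  open import Data.Integer.Properties
  open import Data.Integer.Tactic.RingSolver using (solve-∀)
  open import Relation.Binary.PropositionalEquality

  C = suc c

  X : ℕ → ℕ
  X n = digitSum p ∣ + C * + n ∣

  Y : ℕ → ℕ
  Y n = valuation p ∣ + E * + n + F ∣

  Kₓ : ℤ
  Kₓ = + p * + C * (+ 2 * (+ q * + q) + + 8 * (+ C * + C))

  Kᵧ : ℤ
  Kᵧ = + 3 * + suc (E ℕ.+ ∣ F ∣)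

  K : ℕ
  K = ∣ Kₓ * Kᵧ ∣

  ∑X-deviation²-≤ : ∀ N → 1 ℕ.≤ N → let k = numDigits p N in
    ∑[ n < N ] (+ 2 * + X n - + k * + q) * (+ 2 * + X n - + k * + q) ≤ + N * + k * Kₓ
  ∑X-deviation²-≤ N 1≤N = subst (_≤ + N * + numDigits p N * Kₓ)
    (sumℤ-cong N (λ {n} _ → cong (λ d → d * d) (X≡ n))) (digitSum-deviation-≤ c N 1≤N)
    where
    X≡ : ∀ n → deviation (numDigits p N) (C ℕ.* n) ≡ + 2 * + X n - + numDigits p N * + q
    X≡ n = cong (λ m → + 2 * + digitSum p m - + numDigits p N * + q) (sym (abs-* (+ C) (+ n)))

  ∑Y²-≤ : ∀ N → 1 ℕ.≤ N → ∑[ n < N ] + Y n * + Y n ≤ Kᵧ * + N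
  ∑Y²-≤ N 1≤N = ≤-trans (∑-valuation²-≤ E F z≢0 p∤gcd N) (subst (+ 3 * + A ≤_) reorder (*-monoˡ-≤-nonNeg (+ 3) (+≤+ A≤)))
    where
    A = N ℕ.+ (E ℕ.* N ℕ.+ ∣ F ∣)
    A≤ : A ℕ.≤ suc (E ℕ.+ ∣ F ∣) ℕ.* N
    A≤ = ℕₚ.≤-trans (ℕₚ.+-monoʳ-≤ N (ℕₚ.+-monoʳ-≤ (E ℕ.* N) (ℕₚ.m≤m*n ∣ F ∣ N ⦃ ℕ.>-nonZero 1≤N ⦄)))
                    (ℕₚ.≤-reflexive (expand E ∣ F ∣ N))
      where
      expand : ∀ E f N → N ℕ.+ (E ℕ.* N ℕ.+ f ℕ.* N) ≡ suc (E ℕ.+ f) ℕ.* N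
      expand = ℕ-Ring.solve-∀
    reorder : + 3 * + (suc (E ℕ.+ ∣ F ∣) ℕ.* N) ≡ Kᵧ * + N
    reorder = trans (cong (+ 3 *_) (pos-* (suc (E ℕ.+ ∣ F ∣)) N)) (sym (*-assoc (+ 3) (+ suc (E ℕ.+ ∣ F ∣)) (+ N)))

  covSum²-≤ : ∀ N → 1 ℕ.≤ N → let S = covSum N (λ n → + X n) (λ n → + Y n) in
    S * S ≤ + (K ℕ.* numDigits p N) * (+ N * + N * + N * + N)
  covSum²-≤ N 1≤N = begin
    S * S                                              ≤⟨ S²≤[2S]² ⟩
    (+ 2 * S) * (+ 2 * S)                              ≡⟨ cong (λ s → s * s) (covSum-affine N (+ 2) (- (+ k * + q)) x y) ⟨
    covSum N d y * covSum N d y                        ≤⟨ covSum-bound N d y ⟩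
    + N * + N * (∑[ n < N ] d n * d n) * (∑[ n < N ] y n * y n)
      ≤⟨ *-monoʳ-≤-nonNeg (∑[ n < N ] y n * y n) ⦃ ℤ.nonNegative 0≤∑y² ⦄
           (*-monoˡ-≤-nonNeg (+ N * + N) ⦃ ℤ.nonNegative (square-nonNeg (+ N)) ⦄ (∑X-deviation²-≤ N 1≤N)) ⟩
    + N * + N * (+ N * + k * Kₓ) * (∑[ n < N ] y n * y n)
      ≤⟨ *-monoˡ-≤-nonNeg (+ N * + N * (+ N * + k * Kₓ)) ⦃ ℤ.nonNegative 0≤N³kKₓ ⦄ (∑Y²-≤ N 1≤N) ⟩
    + N * + N * (+ N * + k * Kₓ) * (Kᵧ * + N)          ≡⟨ collect (+ N) (+ k) Kₓ Kᵧ ⟩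
    Kₓ * Kᵧ * + k * (+ N * + N * + N * + N)            ≡⟨ cong (_* (+ N * + N * + N * + N)) K≡ ⟨
    + (K ℕ.* k) * (+ N * + N * + N * + N)              ∎
    where
    open ≤-Reasoning
    k = numDigits p N
    x y d : ℕ → ℤ
    x n = + X n
    y n = + Y n
    d n = + 2 * x n + - (+ k * + q)
    S = covSum N x y
    double : ∀ s → + 3 * (s * s) + s * s ≡ (+ 2 * s) * (+ 2 * s)
    double = solve-∀
    S²≤[2S]² : S * S ≤ (+ 2 * S) * (+ 2 * S)
    S²≤[2S]² = subst (S * S ≤_) (double S)
      (i≤j+i (S * S) (+ 3 * (S * S)) ⦃ ℤ.nonNegative (*-nonNeg {+ 3} (+≤+ z≤n) (square-nonNeg S)) ⦄)
    collect : ∀ N k a b → N * N * (N * k * a) * (b * N) ≡ a * b * k * (N * N * N * N)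
    collect = solve-∀
    0≤Kₓ : 0ℤ ≤ Kₓ
    0≤Kₓ = *-nonNeg {+ p * + C} (*-nonNeg {+ p} {+ C} (+≤+ z≤n) (+≤+ z≤n))
             (+-mono-≤ (*-nonNeg {+ 2} (+≤+ z≤n) (square-nonNeg (+ q))) (*-nonNeg {+ 8} (+≤+ z≤n) (square-nonNeg (+ C))))
    0≤∑y² : 0ℤ ≤ ∑[ n < N ] y n * y n
    0≤∑y² = sumℤ-nonNeg N (λ {n} _ → square-nonNeg (y n))
    0≤N³kKₓ : 0ℤ ≤ + N * + N * (+ N * + k * Kₓ)
    0≤N³kKₓ = *-nonNeg (square-nonNeg (+ N)) (*-nonNeg (*-nonNeg {+ N} {+ k} (+≤+ z≤n) (+≤+ z≤n)) 0≤Kₓ)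
    K≡ : + (K ℕ.* k) ≡ Kₓ * Kᵧ * + k
    K≡ = trans (pos-* K k) (cong (_* + k) (0≤i⇒+∣i∣≡i (*-nonNeg 0≤Kₓ (+≤+ z≤n))))

lemma4 : (p : ℕ) → Prime p → (C E F : ℤ) → 0ℤ <ℤ C → 0ℤ <ℤ E
    → ¬ ((+ p ∣ E) × (+ p ∣ F))
    → ((n : ℕ) → E *ℤ (+ n) +ℤ F ≢ 0ℤ)
    → Σ ℕ λ K → Σ ℕ λ N₀ → (N : ℕ) → N₀ ≤ℕ N
    → Cov N (λ n → digitSum p ∣ C *ℤ (+ n) ∣) (λ n → valuation p ∣ E *ℤ (+ n) +ℤ F ∣)
    *ℚ Cov N (λ n → digitSum p ∣ C *ℤ (+ n) ∣) (λ n → valuation p ∣ E *ℤ (+ n) +ℤ F ∣)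
    ≤ℚ (+ (K *ℕ numDigits p N)) /ℚ 1
lemma4 0 p-prime with () ← prime⇒nonTrivial p-prime
lemma4 1 p-prime with () ← prime⇒nonTrivial p-prime
lemma4 (suc (suc _)) _ (+ 0) _ _ (+<+ ())
lemma4 (suc (suc _)) _ _ (+ 0) _ _ (+<+ ())
lemma4 p@(suc q@(suc _)) p-prime (+ suc c) (+ suc e) F _ _ p∤gcd z≢0 = K , 1 , bound
  where
  open CovarianceBound q p-prime c (suc e) F p∤gcd z≢0
  bound : ∀ N → 1 ≤ℕ N → Cov N X Y *ℚ Cov N X Y ≤ℚ + (K *ℕ numDigits p N) /ℚ 1
  bound N@(suc m) 1≤N = RationalCovariance.Cov²-≤ m X Y (K *ℕ numDigits p N) (covSum²-≤ N 1≤N)
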